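{- Let $F$ be a CNF formula, let $\ell$ be a literal of $F$, and suppose there is a symmetry $\sigma\in\mathrm{Aut}(F)$ with $\sigma(\ell)=\overline\ell$ (negation fixing). Then: (1) $F$ and $F\wedge\{\ell\}$ are equisatisfiable; (2) the unit clause $\{\ell\}$ is substitution redundant (SR) for $F$.
   Context: A literal is a variable $v$ or its negation $\overline v$; a clause is a set (disjunction) of literals; a CNF formula is a set (conjunction) of clauses. Two formulas are equisatisfiable if one is satisfiable iff the other is. A (syntactic) symmetry of $F$ is a permutation $\sigma$ of the literals of $F$ such that $\sigma(F)=F$ (relabeling literals by $\sigma$ yields the same set of clauses) and $\sigma(\overline\ell)=\overline{\sigma(\ell)}$ for all literals $\ell$; $\mathrm{Aut}(F)$ is the group of symmetries. A substitution is a map $\omega$ from the variables of $F$ to literals of $F$ or the constants $\top,\bot$, extended to literals by $\omega(\overline v)=\overline{\omega(v)}$ (with $\overline\top=\bot$). For a formula $G$, $G_{|\omega}$ replaces each literal $\ell$ by $\omega(\ell)$, deleting clauses containing $\top$ and occurrences of $\bot$. $\neg C:=\bigwedge_{\ell\in C}\overline\ell$. $G\vdash_1\bot$ means unit propagation on $G$ yields a conflict; $G\vdash_1 D$ for a clause $D$ means $G\wedge\neg D\vdash_1\bot$; $G\vdash_1 H$ means $G\vdash_1 D$ for all $D\in H$. A clause $C$ is substitution redundant (SR) for $G$ if there is a substitution $\omega$ with $G\wedge\neg C\vdash_1(G\wedge C)_{|\omega}$. -}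

module Defs where

open import Data.Nat using (ℕ)
open import Data.Fin using (Fin)
open import Data.Bool using (Bool; true; false; not)
open import Data.List using (List; []; _∷_; map)
open import Data.Maybe using (Maybe; just; nothing)
open import Data.Product using (Σ; _×_; _,_; ∃)
open import Data.Sum using (_⊎_)
open import Data.List.Membership.Propositional using (_∈_)
open import Data.List.Relation.Unary.All using (All)
open import Data.List.Relation.Unary.Any using (Any)
open import Relation.Binary.PropositionalEquality using (_≡_)
open import Function.Bundles using (_⇔_; _↔_; Inverse)

data Lit (n : ℕ) : Set where
  pos : Fin n → Lit n
  neg : Fin n → Lit n

‾_ : ∀ {n} → Lit n → Lit n
‾ pos v = neg v
‾ neg v = pos v

-- clauses and CNF formulas (lists read as sets)
Clause : ℕ → Set
Clause n = List (Lit n)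

CNF : ℕ → Set
CNF n = List (Clause n)

_∧ᶜ_ : ∀ {n} → CNF n → Clause n → CNF n
F ∧ᶜ C = C ∷ F

¬ᶜ_ : ∀ {n} → Clause n → CNF n
¬ᶜ C = map (λ l → (‾ l) ∷ []) C

_∧_ : ∀ {n} → CNF n → CNF n → CNF n
[] ∧ G = G
(C ∷ F) ∧ G = C ∷ (F ∧ G)

Assignment : ℕ → Set
Assignment n = Fin n → Bool

evalLit : ∀ {n} → Assignment n → Lit n → Bool
evalLit α (pos v) = α v
evalLit α (neg v) = not (α v)

SatClause : ∀ {n} → Assignment n → Clause n → Set
SatClause α C = Any (λ l → evalLit α l ≡ true) C

Satisfies : ∀ {n} → Assignment n → CNF n → Set
Satisfies α F = All (SatClause α) F

Satisfiable : ∀ {n} → CNF n → Set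
Satisfiable {n} F = Σ (Assignment n) λ α → Satisfies α F

Equisatisfiable : ∀ {n} → CNF n → CNF n → Set
Equisatisfiable F G = Satisfiable F ⇔ Satisfiable G

_≈ᶜ_ : ∀ {n} → Clause n → Clause n → Set
C ≈ᶜ D = ∀ l → (l ∈ C) ⇔ (l ∈ D)

_≈ᶠ_ : ∀ {n} → CNF n → CNF n → Set
F ≈ᶠ G = (∀ C → C ∈ F → Σ (Clause _) λ D → D ∈ G × C ≈ᶜ D)
       × (∀ D → D ∈ G → Σ (Clause _) λ C → C ∈ F × C ≈ᶜ D)

applyPerm : ∀ {n} → (Lit n → Lit n) → CNF n → CNF n
applyPerm σ F = map (map σ) F

record Symmetry {n : ℕ} (F : CNF n) : Set where
  field
    perm     : Lit n ↔ Lit n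
    negComm  : ∀ l → Inverse.to perm (‾ l) ≡ ‾ (Inverse.to perm l)
    preserve : applyPerm (Inverse.to perm) F ≈ᶠ F

-- UPConflict F τ : unit propagation on F starting from the trail τ
-- (set of literals assigned true) reaches a conflict.
data UPConflict {n : ℕ} (F : CNF n) : List (Lit n) → Set where
  conflict : ∀ {τ C} → C ∈ F → All (λ l → (‾ l) ∈ τ) C → UPConflict F τ
  propagate : ∀ {τ C l} → C ∈ F → l ∈ C →
              All (λ l′ → l′ ≡ l ⊎ (‾ l′) ∈ τ) C →
              UPConflict F (l ∷ τ) → UPConflict F τ

_⊢₁⊥ : ∀ {n} → CNF n → Set
G ⊢₁⊥ = UPConflict G []

_⊢₁ᶜ_ : ∀ {n} → CNF n → Clause n → Set
G ⊢₁ᶜ D = (G ∧ (¬ᶜ D)) ⊢₁⊥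

_⊢₁_ : ∀ {n} → CNF n → CNF n → Set
G ⊢₁ H = All (G ⊢₁ᶜ_) H

data Val (n : ℕ) : Set where
  lit : Lit n → Val n
  ⊤v  : Val n
  ⊥v  : Val n

negVal : ∀ {n} → Val n → Val n
negVal (lit l) = lit (‾ l)
negVal ⊤v = ⊥v
negVal ⊥v = ⊤v

Substitution : ℕ → Set
Substitution n = Fin n → Val n

substLit : ∀ {n} → Substitution n → Lit n → Val n
substLit ω (pos v) = ω v
substLit ω (neg v) = negVal (ω v)

-- C|ω : nothing if the clause becomes satisfied (contains ⊤),
-- otherwise the mapped clause with ⊥ occurrences removed
restrictClause : ∀ {n} → Substitution n → Clause n → Maybe (Clause n)
restrictClause ω [] = just []
restrictClause ω (l ∷ C) with substLit ω l | restrictClause ω C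
... | ⊤v    | _       = nothing
... | _     | nothing = nothing
... | ⊥v    | just D  = just D
... | lit k | just D  = just (k ∷ D)

_∣_ : ∀ {n} → CNF n → Substitution n → CNF n
[] ∣ ω = []
(C ∷ G) ∣ ω with restrictClause ω C
... | nothing = G ∣ ω
... | just D  = D ∷ (G ∣ ω)

SR : ∀ {n} → CNF n → Clause n → Set
SR {n} G C = Σ (Substitution n) λ ω → (G ∧ (¬ᶜ C)) ⊢₁ ((G ∧ᶜ C) ∣ ω)

{-# OPTIONS --safe #-}
-- If α falsifies ℓ, then α ∘ σ still satisfies F, because σ maps F onto itself, and it makes
-- ℓ true, because σ ℓ = ‾ ℓ.  For redundancy take the substitution ω v := σ (pos v): then
-- (F ∧ ℓ)|ω is σ(F) ∧ ‾ ℓ, and every clause of it is, up to set equality, a clause of F ∧ ¬ℓ,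
-- so unit propagation derives it immediately.
module Submission where

open import Defs
open import Data.Nat using (ℕ)
open import Data.Bool using (true; false; not)
open import Data.Bool.Properties using (not-involutive)
open import Data.List using (List; []; _∷_; map)
open import Data.List.Relation.Unary.All as All using (All; []; _∷_)
open import Data.List.Relation.Unary.All.Properties as All using ()
open import Data.List.Relation.Unary.Any as Any using (here; there)
open import Data.List.Relation.Unary.Any.Properties as Any using ()
open import Data.List.Membership.Propositional using (_∈_)
open import Data.List.Membership.Propositional.Properties using (∈-map⁺)
open import Data.List.Relation.Binary.Subset.Propositional using (_⊆_)
open import Data.List.Relation.Binary.Subset.Propositional.Properties using (⊆-refl; Any-resp-⊆)
open import Data.Maybe using (just)
open import Data.Product using (Σ; _×_; _,_; proj₁)
open import Data.Sum using (_⊎_; inj₁; inj₂)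
open import Function.Bundles using (Inverse; Equivalence; mk⇔)
open import Relation.Binary.PropositionalEquality using (_≡_; refl; sym; trans; cong; module ≡-Reasoning)

module _ {n : ℕ} where

  evalLit-‾ : (α : Assignment n) (l : Lit n) → evalLit α (‾ l) ≡ not (evalLit α l)
  evalLit-‾ α (pos v) = refl
  evalLit-‾ α (neg v) = sym (not-involutive (α v))

  ∈-∧⁺ˡ : {C : Clause n} {F : CNF n} (G : CNF n) → C ∈ F → C ∈ F ∧ G
  ∈-∧⁺ˡ G (here C≡) = here C≡
  ∈-∧⁺ˡ G (there C∈F) = there (∈-∧⁺ˡ G C∈F)

  ∈-∧⁺ʳ : {C : Clause n} (F : CNF n) {G : CNF n} → C ∈ G → C ∈ F ∧ G
  ∈-∧⁺ʳ [] C∈G = C∈G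
  ∈-∧⁺ʳ (_ ∷ F) C∈G = there (∈-∧⁺ʳ F C∈G)

  ‾-∈-¬ᶜ : {l : Lit n} {D : Clause n} → l ∈ D → (‾ l ∷ []) ∈ ¬ᶜ D
  ‾-∈-¬ᶜ (here refl) = here refl
  ‾-∈-¬ᶜ (there l∈D) = there (‾-∈-¬ᶜ l∈D)

  Subsumed : CNF n → Clause n → Set
  Subsumed G D = Σ (Clause n) λ D′ → D′ ∈ G × D′ ⊆ D

  Subsumed-∧ˡ : {F : CNF n} {D : Clause n} (G : CNF n) → Subsumed F D → Subsumed (F ∧ G) D
  Subsumed-∧ˡ G (D′ , D′∈F , D′⊆D) = D′ , ∈-∧⁺ˡ G D′∈F , D′⊆D

  SatClause-subsumed : {α : Assignment n} {G : CNF n} {D : Clause n} →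
    Satisfies α G → Subsumed G D → SatClause α D
  SatClause-subsumed α⊨G (D′ , D′∈G , D′⊆D) = Any-resp-⊆ D′⊆D (All.lookup α⊨G D′∈G)

  -- The literals of L are falsified one by one by propagating the unit clauses ‾ l,
  -- after which every literal of D is false on the trail.
  conflict-after-units : {H : CNF n} {D : Clause n} (L τ : List (Lit n)) → D ∈ H →
    All (λ l → (‾ l ∷ []) ∈ H) L → (∀ {k} → k ∈ D → ‾ k ∈ τ ⊎ k ∈ L) → UPConflict H τ
  conflict-after-units [] τ D∈H [] D-false = conflict D∈H (All.tabulate false-on-τ)
    where
    false-on-τ : ∀ {k} → k ∈ _ → ‾ k ∈ τ
    false-on-τ k∈D with D-false k∈D
    ... | inj₁ ‾k∈τ = ‾k∈τ
  conflict-after-units {D = D} (l ∷ L) τ D∈H (unit ∷ units) D-false =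
    propagate unit (here refl) (inj₁ refl ∷ []) (conflict-after-units L (‾ l ∷ τ) D∈H units D-false′)
    where
    D-false′ : ∀ {k} → k ∈ D → ‾ k ∈ ‾ l ∷ τ ⊎ k ∈ L
    D-false′ k∈D with D-false k∈D
    ... | inj₁ ‾k∈τ        = inj₁ (there ‾k∈τ)
    ... | inj₂ (here refl) = inj₁ (here refl)
    ... | inj₂ (there k∈L) = inj₂ k∈L

  ⊢₁ᶜ-subsumed : {G : CNF n} {D : Clause n} → Subsumed G D → G ⊢₁ᶜ D
  ⊢₁ᶜ-subsumed {G} {D} (D′ , D′∈G , D′⊆D) =
    conflict-after-units D [] (∈-∧⁺ˡ (¬ᶜ D) D′∈G)
      (All.tabulate (λ l∈D → ∈-∧⁺ʳ G (‾-∈-¬ᶜ l∈D))) (λ k∈D′ → inj₂ (D′⊆D k∈D′))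

module NegationCommuting {n : ℕ} (σ : Lit n → Lit n) (σ-‾ : ∀ l → σ (‾ l) ≡ ‾ (σ l)) where

  pullback : Assignment n → Assignment n
  pullback α v = evalLit α (σ (pos v))

  evalLit-pullback : (α : Assignment n) (l : Lit n) → evalLit (pullback α) l ≡ evalLit α (σ l)
  evalLit-pullback α (pos v) = refl
  evalLit-pullback α (neg v) = begin
    not (evalLit α (σ (pos v))) ≡⟨ evalLit-‾ α (σ (pos v)) ⟨
    evalLit α (‾ σ (pos v))     ≡⟨ cong (evalLit α) (σ-‾ (pos v)) ⟨
    evalLit α (σ (neg v))       ∎
    where open ≡-Reasoning

  SatClause-pullback : (α : Assignment n) (C : Clause n) →
    SatClause α (map σ C) → SatClause (pullback α) C
  SatClause-pullback α C σC-sat =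
    Any.map (λ {l} σl-true → trans (evalLit-pullback α l) σl-true) (Any.map⁻ σC-sat)

  substitution : Substitution n
  substitution v = lit (σ (pos v))

  substLit-substitution : (l : Lit n) → substLit substitution l ≡ lit (σ l)
  substLit-substitution (pos v) = refl
  substLit-substitution (neg v) = cong lit (sym (σ-‾ (pos v)))

  restrictClause-substitution : (C : Clause n) → restrictClause substitution C ≡ just (map σ C)
  restrictClause-substitution [] = refl
  restrictClause-substitution (l ∷ C)
    rewrite substLit-substitution l | restrictClause-substitution C = refl

  ∣-substitution : (G : CNF n) → G ∣ substitution ≡ applyPerm σ G
  ∣-substitution [] = refl
  ∣-substitution (C ∷ G) rewrite restrictClause-substitution C | ∣-substitution G = refl

module SymmetryProperties {n : ℕ} {F : CNF n} (σ : Symmetry F) where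

  open Symmetry σ
  open NegationCommuting (Inverse.to perm) negComm public

  image-subsumed : {C : Clause n} → C ∈ F → Subsumed F (map (Inverse.to perm) C)
  image-subsumed {C} C∈F with proj₁ preserve _ (∈-map⁺ (map (Inverse.to perm)) C∈F)
  ... | D , D∈F , σC≈D = D , D∈F , λ {k} k∈D → Equivalence.from (σC≈D k) k∈D

  Satisfies-pullback : {α : Assignment n} → Satisfies α F → Satisfies (pullback α) F
  Satisfies-pullback {α} α⊨F =
    All.tabulate λ {C} C∈F → SatClause-pullback α C (SatClause-subsumed α⊨F (image-subsumed C∈F))

  ∧-⊢₁-image : (G : CNF n) → (F ∧ G) ⊢₁ applyPerm (Inverse.to perm) F
  ∧-⊢₁-image G = All.map⁺ (All.tabulate λ C∈F → ⊢₁ᶜ-subsumed (Subsumed-∧ˡ G (image-subsumed C∈F)))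

theorem3 : ∀ {n : ℕ} (F : CNF n) (ℓ : Lit n) (σ : Symmetry F) →
    Inverse.to (Symmetry.perm σ) ℓ ≡ ‾ ℓ →
    Equisatisfiable F (F ∧ᶜ (ℓ ∷ [])) × SR F (ℓ ∷ [])
theorem3 F ℓ σ σℓ≡‾ℓ = mk⇔ add-ℓ drop-ℓ , (substitution , entails)
  where
  open SymmetryProperties σ
  open ≡-Reasoning

  add-ℓ : Satisfiable F → Satisfiable (F ∧ᶜ (ℓ ∷ []))
  add-ℓ (α , α⊨F) with evalLit α ℓ in αℓ
  ... | true  = α , here αℓ ∷ α⊨F
  ... | false = pullback α , here ℓ-true ∷ Satisfies-pullback α⊨F
    where
    ℓ-true : evalLit (pullback α) ℓ ≡ true
    ℓ-true = begin
      evalLit (pullback α) ℓ                     ≡⟨ evalLit-pullback α ℓ ⟩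
      evalLit α (Inverse.to (Symmetry.perm σ) ℓ) ≡⟨ cong (evalLit α) σℓ≡‾ℓ ⟩
      evalLit α (‾ ℓ)                            ≡⟨ evalLit-‾ α ℓ ⟩
      not (evalLit α ℓ)                          ≡⟨ cong not αℓ ⟩
      true                                       ∎

  drop-ℓ : Satisfiable (F ∧ᶜ (ℓ ∷ [])) → Satisfiable F
  drop-ℓ (α , _ ∷ α⊨F) = α , α⊨F

  entails : (F ∧ (¬ᶜ (ℓ ∷ []))) ⊢₁ ((F ∧ᶜ (ℓ ∷ [])) ∣ substitution)
  entails rewrite ∣-substitution (F ∧ᶜ (ℓ ∷ [])) | σℓ≡‾ℓ =
    ⊢₁ᶜ-subsumed (‾ ℓ ∷ [] , ∈-∧⁺ʳ F (here refl) , ⊆-refl) ∷ ∧-⊢₁-image (¬ᶜ (ℓ ∷ []))
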